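{- Let $n\ge 5$ be an integer and let $M$ be the $0/1$ matrix whose rows are indexed by the $\binom{n}{2}$ edges of the complete graph $K_n$ and whose columns are indexed by the $3\binom{n}{4}$ cycles of length $4$ in $K_n$, with $M_{e,C}=1$ if and only if the edge $e$ lies in the $4$-cycle $C$. Then $M$ has full rank, i.e. (over $\mathbb{R}$) its rank equals $\binom{n}{2}$.
   Context: A cycle $(v_1,v_2,v_3,v_4)$ in $K_n$ is the subgraph on four distinct vertices $v_1,\dots,v_4$ with edge set $\{\{v_1,v_2\},\{v_2,v_3\},\{v_3,v_4\},\{v_4,v_1\}\}$; two such cycles are the same if they have the same edge set. -}

module Defs where

open import Data.Nat using (ℕ)
open import Data.Fin using (Fin; _<_; _<?_; _≟_)
open import Data.Product using (Σ; _×_; _,_; proj₁; proj₂)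
open import Data.List using (List; []; _∷_; map; concatMap; foldr)
open import Data.Fin using () renaming (_≟_ to _≟ᶠ_)
open import Data.List using (allFin)
open import Data.Bool using (Bool; true; false; _∧_; _∨_; if_then_else_)
open import Relation.Nullary using (¬_)
open import Relation.Nullary.Decidable using (⌊_⌋; yes; no)
open import Relation.Binary.PropositionalEquality using (_≡_)
open import Data.Rational using (ℚ; 0ℚ; 1ℚ; _+_; _*_)

-- An edge of K_n: an unordered pair {i,j}, represented canonically by i < j.
Edge : ℕ → Set
Edge n = Σ (Fin n × Fin n) (λ p → proj₁ p < proj₂ p)

allEdges : (n : ℕ) → List (Edge n)
allEdges n = concatMap (λ i → concatMap (λ j → pick i j) (allFin n)) (allFin n)
  where
  pick : Fin n → Fin n → List (Edge n)
  pick i j with i <? j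
  ... | yes i<j = ((i , j) , i<j) ∷ []
  ... | no _    = []

record Cycle4 (n : ℕ) : Set where
  field
    v1 v2 v3 v4 : Fin n
    d12 : ¬ v1 ≡ v2
    d13 : ¬ v1 ≡ v3
    d14 : ¬ v1 ≡ v4
    d23 : ¬ v2 ≡ v3
    d24 : ¬ v2 ≡ v4
    d34 : ¬ v3 ≡ v4

sameEdge : {n : ℕ} → Fin n → Fin n → Fin n → Fin n → Bool
sameEdge i j a b = (⌊ i ≟ a ⌋ ∧ ⌊ j ≟ b ⌋) ∨ (⌊ i ≟ b ⌋ ∧ ⌊ j ≟ a ⌋)

inCycle : {n : ℕ} → Edge n → Cycle4 n → Bool
inCycle ((i , j) , _) C =
  sameEdge i j v1 v2 ∨ sameEdge i j v2 v3 ∨ sameEdge i j v3 v4 ∨ sameEdge i j v4 v1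
  where open Cycle4 C

incidence : (n : ℕ) → Edge n → Cycle4 n → ℚ
incidence n e C = if inCycle e C then 1ℚ else 0ℚ

sumℚ : List ℚ → ℚ
sumℚ = foldr _+_ 0ℚ

FullRowRank : (n : ℕ) → (Edge n → Cycle4 n → ℚ) → Set
FullRowRank n M =
  (x : Edge n → ℚ) →
  (∀ (C : Cycle4 n) → sumℚ (map (λ e → x e * M e C) (allEdges n)) ≡ 0ℚ) →
  ∀ (e : Edge n) → x e ≡ 0ℚ

-- Let x be a row vector with x·M = 0 and let w(u,v) be the value of x on the edge uv.
-- For a 4-cycle C = (v1 v2 v3 v4) the columns of C, (v1 v2 v4 v3) and (v1 v3 v2 v4) satisfy
-- C + (v1 v2 v4 v3) − (v1 v3 v2 v4) = 2(e₁₂ + e₃₄), so w(v1,v2) + w(v3,v4) = 0 for any two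
-- disjoint edges. An edge ab together with three further vertices c, d, e (this is where
-- n ≥ 5 enters) gives the chain of disjoint pairs ab, cd, be, ac, de, ab of odd length,
-- whence w(a,b) = −w(a,b) = 0.
module Submission where

open import Defs
open import Data.Nat using (ℕ; suc; _≤_; s≤s)
open import Data.Fin using (Fin; zero; suc; _<_; _<?_; _≟_; inject₁; punchIn; punchOut; _↑ˡ_)
open import Data.Fin.Properties
  using ( suc-injective; <-irrelevant; <-asym; <⇒≢; all?
        ; punchIn-injective; punchInᵢ≢i; punchIn-punchOut; ↑ˡ-injective )
open import Data.Fin.Patterns using (0F; 1F; 2F; 3F; 4F)
open import Data.List using (List; []; _∷_; _++_; map; concatMap; allFin)
open import Data.List.Properties using (map-tabulate)
open import Data.Vec using (Vec; lookup)
import Data.Vec as Vec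
import Data.Vec.Functional as Vector
open import Data.Product using (Σ; ∃; _×_; _,_; proj₁; proj₂)
open import Data.Sum using (inj₁; inj₂)
open import Data.Bool using (Bool; true; false; T; _∧_; _∨_; if_then_else_)
open import Data.Bool.Properties using (T-∧; T-∨; T-≡)
open import Data.Empty using (⊥-elim)
open import Data.Rational using (ℚ; 0ℚ; 1ℚ; ½; _+_; _*_)
import Data.Rational.Properties as ℚ
open import Algebra.Bundles using (Group)
open import Function using (_∘_; id; Equivalence)
open import Function.Definitions using (Injective)
open import Relation.Nullary using (¬_; Dec; yes; no)
open import Relation.Nullary.Decidable using (⌊_⌋; from-yes; toWitness)
open import Relation.Binary.PropositionalEquality

private
  variable
    A B : Set

sumOver : List A → (A → ℚ) → ℚ
sumOver xs f = sumℚ (map f xs)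

sumOver-cong : (xs : List A) {f g : A → ℚ} → (∀ x → f x ≡ g x) → sumOver xs f ≡ sumOver xs g
sumOver-cong []       f≗g = refl
sumOver-cong (x ∷ xs) f≗g = cong₂ _+_ (f≗g x) (sumOver-cong xs f≗g)

sumOver-zero : (xs : List A) {f : A → ℚ} → (∀ x → f x ≡ 0ℚ) → sumOver xs f ≡ 0ℚ
sumOver-zero []       f≗0 = refl
sumOver-zero (x ∷ xs) f≗0 = cong₂ _+_ (f≗0 x) (sumOver-zero xs f≗0)

sumOver-+ : (xs : List A) (f g : A → ℚ) →
            sumOver xs (λ x → f x + g x) ≡ sumOver xs f + sumOver xs g
sumOver-+ []       f g = refl
sumOver-+ (x ∷ xs) f g = begin
  (f x + g x) + sumOver xs (λ x → f x + g x)    ≡⟨ cong (f x + g x +_) (sumOver-+ xs f g) ⟩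
  (f x + g x) + (sumOver xs f + sumOver xs g)    ≡⟨ ℚ.+-assoc (f x) (g x) _ ⟩
  f x + (g x + (sumOver xs f + sumOver xs g))    ≡⟨ cong (f x +_) (ℚ.+-comm (g x) _) ⟩
  f x + ((sumOver xs f + sumOver xs g) + g x)    ≡⟨ cong (f x +_) (ℚ.+-assoc (sumOver xs f) _ (g x)) ⟩
  f x + (sumOver xs f + (sumOver xs g + g x))    ≡⟨ sym (ℚ.+-assoc (f x) _ _) ⟩
  (f x + sumOver xs f) + (sumOver xs g + g x)    ≡⟨ cong (f x + sumOver xs f +_) (ℚ.+-comm _ (g x)) ⟩
  (f x + sumOver xs f) + (g x + sumOver xs g)    ∎
  where open ≡-Reasoning

sumOver-++ : (xs ys : List A) (f : A → ℚ) → sumOver (xs ++ ys) f ≡ sumOver xs f + sumOver ys f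
sumOver-++ []       ys f = sym (ℚ.+-identityˡ _)
sumOver-++ (x ∷ xs) ys f = trans (cong (f x +_) (sumOver-++ xs ys f)) (sym (ℚ.+-assoc (f x) _ _))

sumOver-concatMap : (g : A → List B) (xs : List A) (f : B → ℚ) →
                    sumOver (concatMap g xs) f ≡ sumOver xs (λ x → sumOver (g x) f)
sumOver-concatMap g []       f = refl
sumOver-concatMap g (x ∷ xs) f =
  trans (sumOver-++ (g x) (concatMap g xs) f) (cong (sumOver (g x) f +_) (sumOver-concatMap g xs f))

sumOver-allFin-suc : ∀ {n} (f : Fin (suc n) → ℚ) →
                     sumOver (allFin (suc n)) f ≡ f zero + sumOver (allFin n) (f ∘ suc)
sumOver-allFin-suc f =
  cong (λ xs → f zero + sumℚ xs) (trans (map-tabulate suc f) (sym (map-tabulate id (f ∘ suc))))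

sumOver-allFin-point : ∀ {n} (f : Fin n → ℚ) (a : Fin n) → (∀ k → k ≢ a → f k ≡ 0ℚ) →
                       sumOver (allFin n) f ≡ f a
sumOver-allFin-point f zero f≗0 = begin
  sumOver (allFin _) f                      ≡⟨ sumOver-allFin-suc f ⟩
  f zero + sumOver (allFin _) (f ∘ suc)
    ≡⟨ cong (f zero +_) (sumOver-zero (allFin _) λ k → f≗0 (suc k) λ ()) ⟩
  f zero + 0ℚ                               ≡⟨ ℚ.+-identityʳ (f zero) ⟩
  f zero                                    ∎
  where open ≡-Reasoning
sumOver-allFin-point f (suc a) f≗0 = begin
  sumOver (allFin _) f                      ≡⟨ sumOver-allFin-suc f ⟩
  f zero + sumOver (allFin _) (f ∘ suc)
    ≡⟨ cong₂ _+_ (f≗0 zero λ ())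
                 (sumOver-allFin-point (f ∘ suc) a λ k k≢a → f≗0 (suc k) (k≢a ∘ suc-injective)) ⟩
  0ℚ + f (suc a)                            ≡⟨ ℚ.+-identityˡ (f (suc a)) ⟩
  f (suc a)                                 ∎
  where open ≡-Reasoning

-- The local helper of allEdges has no name; unification recovers it from the definition.
allEdges-cells : ∀ n → Σ (Fin n → Fin n → List (Edge n)) λ cell →
                 allEdges n ≡ concatMap (λ i → concatMap (cell i) (allFin n)) (allFin n)
allEdges-cells n = _ , refl

data Cell {n} (i j : Fin n) : List (Edge n) → Set where
  present : (i<j : i < j) → Cell i j (((i , j) , i<j) ∷ [])
  absent  : ¬ i < j → Cell i j []

cell-view : ∀ {n} (i j : Fin n) → Cell i j (proj₁ (allEdges-cells n) i j)
cell-view i j with i <? j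
... | yes i<j = present i<j
... | no  i≮j = absent i≮j

module _ {n} {i j : Fin n} (f : Edge n → ℚ) where

  sumOver-cell-zero : ∀ {es} → Cell i j es → (∀ i<j → f ((i , j) , i<j) ≡ 0ℚ) → sumOver es f ≡ 0ℚ
  sumOver-cell-zero (present i<j) f≗0 = trans (ℚ.+-identityʳ _) (f≗0 i<j)
  sumOver-cell-zero (absent _)    f≗0 = refl

  sumOver-cell-present : ∀ {es} → Cell i j es → (i<j : i < j) → sumOver es f ≡ f ((i , j) , i<j)
  sumOver-cell-present (present i<j′) i<j =
    trans (ℚ.+-identityʳ _) (cong (λ p → f ((i , j) , p)) (<-irrelevant i<j′ i<j))
  sumOver-cell-present (absent i≮j) i<j = ⊥-elim (i≮j i<j)

sumOver-allEdges-point : ∀ {n} (f : Edge n → ℚ) (e : Edge n) →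
                         (∀ e′ → proj₁ e′ ≢ proj₁ e → f e′ ≡ 0ℚ) → sumOver (allEdges n) f ≡ f e
sumOver-allEdges-point {n} f e@((a , b) , a<b) f≗0 = begin
  sumOver (allEdges n) f
    ≡⟨ cong (λ es → sumOver es f) (proj₂ (allEdges-cells n)) ⟩
  sumOver (concatMap (λ i → concatMap (cell i) (allFin n)) (allFin n)) f
    ≡⟨ sumOver-concatMap _ (allFin n) f ⟩
  sumOver (allFin n) (λ i → sumOver (concatMap (cell i) (allFin n)) f)
    ≡⟨ sumOver-cong (allFin n) (λ i → sumOver-concatMap (cell i) (allFin n) f) ⟩
  sumOver (allFin n) (λ i → sumOver (allFin n) (λ j → sumOver (cell i j) f))
    ≡⟨ sumOver-allFin-point _ a (λ i i≢a → sumOver-zero (allFin n) λ j →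
         sumOver-cell-zero f (cell-view i j) λ _ → f≗0 _ (i≢a ∘ cong proj₁)) ⟩
  sumOver (allFin n) (λ j → sumOver (cell a j) f)
    ≡⟨ sumOver-allFin-point _ b (λ j j≢b →
         sumOver-cell-zero f (cell-view a j) λ _ → f≗0 _ (j≢b ∘ cong proj₂)) ⟩
  sumOver (cell a b) f
    ≡⟨ sumOver-cell-present f (cell-view a b) a<b ⟩
  f e ∎
  where
  open ≡-Reasoning
  cell = proj₁ (allEdges-cells n)

indicator : Bool → ℚ
indicator b = if b then 1ℚ else 0ℚ

edgeIndicator : ∀ {n} → Fin n → Fin n → Edge n → ℚ
edgeIndicator u v ((i , j) , _) = indicator (sameEdge i j u v)

sameEdge-sorted : ∀ {n} {i j a b : Fin n} → i < j → a < b → T (sameEdge i j a b) → (i , j) ≡ (a , b)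
sameEdge-sorted {i = i} {j} {a} {b} i<j a<b same with Equivalence.to T-∨ same
... | inj₁ i≡a∧j≡b with Equivalence.to T-∧ i≡a∧j≡b
...   | i≡a , j≡b = cong₂ _,_ (toWitness {a? = i ≟ a} i≡a) (toWitness {a? = j ≟ b} j≡b)
sameEdge-sorted {i = i} {j} {a} {b} i<j a<b same | inj₂ i≡b∧j≡a with Equivalence.to T-∧ i≡b∧j≡a
...   | i≡b , j≡a = ⊥-elim (<-asym a<b b<a)
  where
  b<a : b < a
  b<a = subst₂ _<_ (toWitness {a? = i ≟ b} i≡b) (toWitness {a? = j ≟ a} j≡a) i<j

sameEdge-refl : ∀ {n} (a b : Fin n) → sameEdge a b a b ≡ true
sameEdge-refl a b rewrite ≡-≟-identity _≟_ {a} refl | ≡-≟-identity _≟_ {b} refl = refl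

module _ {n : ℕ} (x : Edge n → ℚ) where

  dot : (Edge n → ℚ) → ℚ
  dot w = sumOver (allEdges n) (λ e → x e * w e)

  weight : Fin n → Fin n → ℚ
  weight u v = dot (edgeIndicator u v)

  dot-cong : {w₁ w₂ : Edge n → ℚ} → (∀ e → w₁ e ≡ w₂ e) → dot w₁ ≡ dot w₂
  dot-cong w₁≗w₂ = sumOver-cong (allEdges n) (λ e → cong (x e *_) (w₁≗w₂ e))

  dot-+ : (w₁ w₂ : Edge n → ℚ) → dot (λ e → w₁ e + w₂ e) ≡ dot w₁ + dot w₂
  dot-+ w₁ w₂ = trans (sumOver-cong (allEdges n) (λ e → ℚ.*-distribˡ-+ (x e) (w₁ e) (w₂ e)))
                      (sumOver-+ (allEdges n) (λ e → x e * w₁ e) (λ e → x e * w₂ e))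

  weight-endpoints : (e : Edge n) → weight (proj₁ (proj₁ e)) (proj₂ (proj₁ e)) ≡ x e
  weight-endpoints e@((a , b) , a<b) = trans (sumOver-allEdges-point _ e vanish) at-e
    where
    vanish : ∀ e′ → proj₁ e′ ≢ (a , b) → x e′ * edgeIndicator a b e′ ≡ 0ℚ
    vanish e′@((i , j) , i<j) ij≢ab with sameEdge i j a b in same
    ... | true  = ⊥-elim (ij≢ab (sameEdge-sorted i<j a<b (Equivalence.from T-≡ same)))
    ... | false = ℚ.*-zeroʳ (x e′)
    at-e : x e * edgeIndicator a b e ≡ x e
    at-e rewrite sameEdge-refl a b = ℚ.*-identityʳ (x e)

-- Together with C, these are the three 4-cycles on the vertex set of C.
swap₃₄ swap₂₃ : ∀ {n} → Cycle4 n → Cycle4 n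
swap₃₄ C = record
  { v1 = v1 ; v2 = v2 ; v3 = v4 ; v4 = v3
  ; d12 = d12 ; d13 = d14 ; d14 = d13 ; d23 = d24 ; d24 = d23 ; d34 = d34 ∘ sym }
  where open Cycle4 C
swap₂₃ C = record
  { v1 = v1 ; v2 = v3 ; v3 = v2 ; v4 = v4
  ; d12 = d13 ; d13 = d12 ; d14 = d14 ; d23 = d23 ∘ sym ; d24 = d34 ; d34 = d24 }
  where open Cycle4 C

-- The possible profiles: equal to the k-th vertex (k < 4), or to none (k = 4).
slot : Fin 5 → Vec Bool 4
slot p = Vec.tabulate (λ k → ⌊ p ≟ inject₁ k ⌋)

module _ {n} (C : Cycle4 n) where
  open Cycle4 C

  vertex : Fin 4 → Fin n
  vertex 0F = v1
  vertex 1F = v2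
  vertex 2F = v3
  vertex 3F = v4

  profile : Fin n → Vec Bool 4
  profile i = Vec.tabulate (λ k → ⌊ i ≟ vertex k ⌋)

  profile-slot : (i : Fin n) → ∃ λ p → profile i ≡ slot p
  profile-slot i with i ≟ v1
  ... | yes refl
    rewrite ≢-≟-identity _≟_ d12 | ≢-≟-identity _≟_ d13 | ≢-≟-identity _≟_ d14 = 0F , refl
  ... | no _ with i ≟ v2
  ...   | yes refl rewrite ≢-≟-identity _≟_ d23 | ≢-≟-identity _≟_ d24 = 1F , refl
  ...   | no _ with i ≟ v3
  ...     | yes refl rewrite ≢-≟-identity _≟_ d34 = 2F , refl
  ...     | no _ with i ≟ v4
  ...       | yes refl = 3F , refl
  ...       | no _ = 4F , refl

-- sameEdge i j (vertex C k) (vertex C l), read off the profiles I and J of i and j.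
joins : Vec Bool 4 → Vec Bool 4 → Fin 4 → Fin 4 → Bool
joins I J k l = (lookup I k ∧ lookup J l) ∨ (lookup I l ∧ lookup J k)

cycleValue : Vec Bool 4 → Vec Bool 4 → Fin 4 → Fin 4 → Fin 4 → Fin 4 → ℚ
cycleValue I J k₁ k₂ k₃ k₄ =
  indicator (joins I J k₁ k₂ ∨ joins I J k₂ k₃ ∨ joins I J k₃ k₄ ∨ joins I J k₄ k₁)

MatchingIdentity : Vec Bool 4 → Vec Bool 4 → Set
MatchingIdentity I J =
  cycleValue I J 0F 1F 2F 3F + cycleValue I J 0F 1F 3F 2F ≡ cycleValue I J 0F 2F 1F 3F + (m + m)
  where m = indicator (joins I J 0F 1F) + indicator (joins I J 2F 3F)

matchingIdentity-slot : ∀ p q → MatchingIdentity (slot p) (slot q)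
matchingIdentity-slot = from-yes (all? λ p → all? λ q → matchingIdentity? (slot p) (slot q))
  where
  matchingIdentity? : ∀ I J → Dec (MatchingIdentity I J)
  matchingIdentity? I J = _ ℚ.≟ _

column : ∀ {n} → Cycle4 n → Edge n → ℚ
column C e = incidence _ e C

-- Both sides depend only on the slots of the two endpoints: 25 cases, checked by evaluation.
column-matching : ∀ {n} (C : Cycle4 n) (e : Edge n) →
  let open Cycle4 C
      m = edgeIndicator v1 v2 e + edgeIndicator v3 v4 e
  in column C e + column (swap₃₄ C) e ≡ column (swap₂₃ C) e + (m + m)
column-matching C ((i , j) , _) with profile-slot C i | profile-slot C j
... | p , i↦p | q , j↦q = subst₂ MatchingIdentity (sym i↦p) (sym j↦q) (matchingIdentity-slot p q)

module GroupLemma {c ℓ} (G : Group c ℓ) where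
  open Group G using (_≈_; _∙_; ε) renaming (trans to ≈-trans; sym to ≈-sym)
  open import Algebra.Properties.Group G using (inverseˡ-unique; inverseʳ-unique)

  leftInverse≈rightInverse : ∀ {x y z} → x ∙ y ≈ ε → y ∙ z ≈ ε → x ≈ z
  leftInverse≈rightInverse {x} {y} {z} xy≈ε yz≈ε =
    ≈-trans (inverseˡ-unique x y xy≈ε) (≈-sym (inverseʳ-unique y z yz≈ε))

double≡0⇒≡0 : ∀ {t} → t + t ≡ 0ℚ → t ≡ 0ℚ
double≡0⇒≡0 {t} t+t≡0 = begin
  t                   ≡⟨ sym (ℚ.*-identityʳ t) ⟩
  t * (½ + ½)         ≡⟨ ℚ.*-distribˡ-+ t ½ ½ ⟩
  t * ½ + t * ½       ≡⟨ sym (ℚ.*-distribʳ-+ ½ t t) ⟩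
  (t + t) * ½         ≡⟨ cong (_* ½) t+t≡0 ⟩
  0ℚ * ½              ≡⟨ ℚ.*-zeroˡ ½ ⟩
  0ℚ                  ∎
  where open ≡-Reasoning

alternating-pentagon : ∀ {x₁ x₂ x₃ x₄ x₅} →
  x₁ + x₂ ≡ 0ℚ → x₂ + x₃ ≡ 0ℚ → x₃ + x₄ ≡ 0ℚ → x₄ + x₅ ≡ 0ℚ → x₅ + x₁ ≡ 0ℚ → x₁ ≡ 0ℚ
alternating-pentagon {x₁} {x₅ = x₅} h₁₂ h₂₃ h₃₄ h₄₅ h₅₁ =
  double≡0⇒≡0 (trans (cong (_+ x₁) x₁≡x₅) h₅₁)
  where
  open GroupLemma ℚ.+-0-group using (leftInverse≈rightInverse)
  x₁≡x₅ : x₁ ≡ x₅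
  x₁≡x₅ = trans (leftInverse≈rightInverse h₁₂ h₂₃) (leftInverse≈rightInverse h₃₄ h₄₅)

module LeftKernel {n : ℕ} (x : Edge n → ℚ) (x∈ker : ∀ C → dot x (column C) ≡ 0ℚ) where

  matching-weight : (C : Cycle4 n) → let open Cycle4 C in weight x v1 v2 + weight x v3 v4 ≡ 0ℚ
  matching-weight C = double≡0⇒≡0 (begin
    t + t                                         ≡⟨ sym (ℚ.+-identityˡ _) ⟩
    0ℚ + (t + t)
      ≡⟨ cong₂ _+_ (sym (x∈ker (swap₂₃ C))) (cong (λ s → s + s) dot-m) ⟩
    dot x (column (swap₂₃ C)) + (dot x m + dot x m)
      ≡⟨ cong (dot x (column (swap₂₃ C)) +_) (sym (dot-+ x m m)) ⟩
    dot x (column (swap₂₃ C)) + dot x (λ e → m e + m e)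
      ≡⟨ sym (dot-+ x (column (swap₂₃ C)) _) ⟩
    dot x (λ e → column (swap₂₃ C) e + (m e + m e))
      ≡⟨ dot-cong x (λ e → sym (column-matching C e)) ⟩
    dot x (λ e → column C e + column (swap₃₄ C) e)
      ≡⟨ dot-+ x (column C) (column (swap₃₄ C)) ⟩
    dot x (column C) + dot x (column (swap₃₄ C))  ≡⟨ cong₂ _+_ (x∈ker C) (x∈ker (swap₃₄ C)) ⟩
    0ℚ + 0ℚ                                       ≡⟨ ℚ.+-identityʳ 0ℚ ⟩
    0ℚ                                            ∎)
    where
    open ≡-Reasoning
    open Cycle4 C
    m : Edge n → ℚ
    m e = edgeIndicator v1 v2 e + edgeIndicator v3 v4 e
    t : ℚ
    t = weight x v1 v2 + weight x v3 v4
    dot-m : t ≡ dot x m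
    dot-m = sym (dot-+ x (edgeIndicator v1 v2) (edgeIndicator v3 v4))

  weight-K₅ : (v : Fin 5 → Fin n) → Injective _≡_ _≡_ v → weight x (v 0F) (v 1F) ≡ 0ℚ
  weight-K₅ v v-injective = alternating-pentagon
    (matching-weight (cycleOn 0F 1F 2F 3F (λ ()) (λ ()) (λ ()) (λ ()) (λ ()) (λ ())))
    (matching-weight (cycleOn 2F 3F 1F 4F (λ ()) (λ ()) (λ ()) (λ ()) (λ ()) (λ ())))
    (matching-weight (cycleOn 1F 4F 0F 2F (λ ()) (λ ()) (λ ()) (λ ()) (λ ()) (λ ())))
    (matching-weight (cycleOn 0F 2F 3F 4F (λ ()) (λ ()) (λ ()) (λ ()) (λ ()) (λ ())))
    (matching-weight (cycleOn 3F 4F 0F 1F (λ ()) (λ ()) (λ ()) (λ ()) (λ ()) (λ ())))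
    where
    cycleOn : (k₁ k₂ k₃ k₄ : Fin 5) →
              k₁ ≢ k₂ → k₁ ≢ k₃ → k₁ ≢ k₄ → k₂ ≢ k₃ → k₂ ≢ k₄ → k₃ ≢ k₄ → Cycle4 n
    cycleOn k₁ k₂ k₃ k₄ k₁₂ k₁₃ k₁₄ k₂₃ k₂₄ k₃₄ = record
      { v1 = v k₁ ; v2 = v k₂ ; v3 = v k₃ ; v4 = v k₄
      ; d12 = k₁₂ ∘ v-injective ; d13 = k₁₃ ∘ v-injective ; d14 = k₁₄ ∘ v-injective
      ; d23 = k₂₃ ∘ v-injective ; d24 = k₂₄ ∘ v-injective ; d34 = k₃₄ ∘ v-injective }

punchIn-cons-injective : ∀ {k n} (a : Fin (suc n)) {f : Fin k → Fin n} →
                         Injective _≡_ _≡_ f → Injective _≡_ _≡_ (a Vector.∷ punchIn a ∘ f)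
punchIn-cons-injective a _ {zero}  {zero}  _  = refl
punchIn-cons-injective a {f} _ {zero}  {suc l} eq = ⊥-elim (punchInᵢ≢i a (f l) (sym eq))
punchIn-cons-injective a {f} _ {suc k} {zero}  eq = ⊥-elim (punchInᵢ≢i a (f k) eq)
punchIn-cons-injective a {f} f-injective {suc k} {suc l} eq =
  cong suc (f-injective (punchIn-injective a (f k) (f l) eq))

extend-pair : ∀ {n} → 5 ≤ n → (a b : Fin n) → a ≢ b →
              ∃ λ (v : Fin 5 → Fin n) → Injective _≡_ _≡_ v × v 0F ≡ a × v 1F ≡ b
extend-pair (s≤s (s≤s (s≤s (s≤s (s≤s {n = m} _))))) a b a≢b =
  a Vector.∷ punchIn a ∘ (b′ Vector.∷ punchIn b′ ∘ (_↑ˡ m)) ,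
  punchIn-cons-injective a (punchIn-cons-injective b′ (↑ˡ-injective m _ _)) ,
  refl ,
  punchIn-punchOut a≢b
  where b′ = punchOut a≢b

mainTheorem1 : (n : ℕ) → 5 ≤ n → FullRowRank n (incidence n)
mainTheorem1 n 5≤n x x∈ker e@((a , b) , a<b) with extend-pair 5≤n a b (<⇒≢ a<b)
... | v , v-injective , refl , v1≡b = begin
  x e                     ≡⟨ sym (weight-endpoints x e) ⟩
  weight x (v 0F) b       ≡⟨ cong (weight x (v 0F)) (sym v1≡b) ⟩
  weight x (v 0F) (v 1F)  ≡⟨ LeftKernel.weight-K₅ x x∈ker v v-injective ⟩
  0ℚ                      ∎
  where open ≡-Reasoning
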